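{- Let $\Gamma,\Delta'$ be finite multisets of formulas such that the sequent $\Gamma\vdash\Delta'$ has a proof in the cut-free classical sequent calculus. Let $A$ be either a single formula or empty, and let $\Delta$ be a multiset such that $\Delta'=A,\Delta$. Then the focused sequent $\Gamma\vdash A;\Delta$ (that is, $\Gamma\vdash .;\Delta$ when $A$ is empty) has a proof in the focused classical sequent calculus.
   Context: Formulas are first-order formulas built from atomic formulas with $\wedge,\vee,\Rightarrow,\neg,\forall,\exists$. The cut-free classical sequent calculus on sequents $\Gamma\vdash\Delta$ (finite multisets) has: axiom $\Gamma,A\vdash A,\Delta$; the usual left and right rules for $\wedge,\vee,\Rightarrow,\neg,\forall,\exists$ (with $\vee_R$: from $\Gamma\vdash A,B,\Delta$ infer $\Gamma\vdash A\vee B,\Delta$; $\Rightarrow_L$: from $\Gamma\vdash A,\Delta$ and $\Gamma,B\vdash\Delta$ infer $\Gamma,A\Rightarrow B\vdash\Delta$; fresh constant in $\forall_R,\exists_L$, arbitrary term in $\forall_L,\exists_R$); contraction and weakening on both sides; no cut. A focused sequent is $\Gamma\vdash S;\Delta$ where $\Gamma,\Delta$ are finite multisets and the stoup $S$ is either one formula $A$ (written $\Gamma\vdash A;\Delta$) or empty (written $\Gamma\vdash .;\Delta$). The focused classical sequent calculus has the rules: ax: $\Gamma,A\vdash .;A,\Delta$ with $A$ atomic; $\wedge_L$: from $\Gamma,A,B\vdash .;\Delta$ infer $\Gamma,A\wedge B\vdash .;\Delta$; $\wedge_R$: from $\Gamma\vdash A;\Delta$ and $\Gamma\vdash B;\Delta$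 infer $\Gamma\vdash A\wedge B;\Delta$; $\vee_L$: from $\Gamma,A\vdash .;\Delta$ and $\Gamma,B\vdash .;\Delta$ infer $\Gamma,A\vee B\vdash .;\Delta$; $\vee_R$: from $\Gamma\vdash .;A,B,\Delta$ infer $\Gamma\vdash .;A\vee B,\Delta$; $\Rightarrow_L$: from $\Gamma\vdash A;\Delta$ and $\Gamma,B\vdash .;\Delta$ infer $\Gamma,A\Rightarrow B\vdash .;\Delta$; $\Rightarrow_R$: from $\Gamma,A\vdash B;\Delta$ infer $\Gamma\vdash A\Rightarrow B;\Delta$; $\neg_L$: from $\Gamma\vdash A;\Delta$ infer $\Gamma,\neg A\vdash .;\Delta$; $\neg_R$: from $\Gamma,A\vdash .;\Delta$ infer $\Gamma\vdash .;\neg A,\Delta$; $\exists_L$: from $\Gamma,A[c/x]\vdash .;\Delta$ infer $\Gamma,\exists xA\vdash .;\Delta$; $\exists_R$: from $\Gamma\vdash .;A[t/x],\Delta$ infer $\Gamma\vdash .;\exists xA,\Delta$; $\forall_L$: from $\Gamma,A[t/x]\vdash .;\Delta$ infer $\Gamma,\forall xA\vdash .;\Delta$; $\forall_R$: from $\Gamma\vdash A[c/x];\Delta$ infer $\Gamma\vdash\forall xA;\Delta$; contr$_L$: from $\Gamma,A,A\vdash .;\Delta$ infer $\Gamma,A\vdash .;\Delta$; contr$_R$: from $\Gamma\vdash .;A,A,\Delta$ infer $\Gamma\vdash .;A,\Delta$; weak$_L$: from $\Gamma\vdash .;\Delta$ infer $\Gamma,A\vdash .;\Delta$; weak$_R$: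 from $\Gamma\vdash .;\Delta$ infer $\Gamma\vdash A;\Delta$; focus: from $\Gamma\vdash A;\Delta$ infer $\Gamma\vdash .;A,\Delta$, provided $A$ is neither atomic nor of the form $\exists xB$, $B\vee C$, $\neg B$; release: from $\Gamma\vdash .;A,\Delta$ infer $\Gamma\vdash A;\Delta$, provided $A$ is atomic or of the form $\exists xB$, $B\vee C$ or $\neg B$. In $\forall_R$ and $\exists_L$, $c$ is a fresh constant; in $\forall_L$ and $\exists_R$, $t$ is any term. -}

module Defs where

open import Data.Nat using (ℕ; suc)
open import Data.Fin using (Fin; zero; suc)
open import Data.List using (List; []; _∷_; _++_)
open import Data.Maybe using (Maybe; just; nothing)
open import Data.List.Membership.Propositional using (_∈_)
open import Data.List.Relation.Binary.Permutation.Propositional using (_↭_)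
open import Relation.Nullary using (¬_)

-- First-order syntax (well-scoped de Bruijn indices for bound variables).
-- Function symbols (and constants = nullary function symbols) and
-- predicate symbols are named by natural numbers.

data Term (n : ℕ) : Set where
  var : Fin n → Term n
  fun : ℕ → List (Term n) → Term n

data Formula (n : ℕ) : Set where
  atom : ℕ → List (Term n) → Formula n
  and  : Formula n → Formula n → Formula n
  or   : Formula n → Formula n → Formula n
  imp  : Formula n → Formula n → Formula n
  neg  : Formula n → Formula n
  all  : Formula (suc n) → Formula n
  ex   : Formula (suc n) → Formula n

-- closed terms / formulas (the objects occurring in sequents)
Tm : Set
Tm = Term 0

Fm : Set
Fm = Formula 0

cst : ℕ → Tm
cst c = fun c []

mutual
  renT : ∀ {n m} → (Fin n → Fin m) → Term n → Term m
  renT ρ (var i) = var (ρ i)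
  renT ρ (fun f ts) = fun f (renTs ρ ts)

  renTs : ∀ {n m} → (Fin n → Fin m) → List (Term n) → List (Term m)
  renTs ρ [] = []
  renTs ρ (t ∷ ts) = renT ρ t ∷ renTs ρ ts

mutual
  subT : ∀ {n m} → (Fin n → Term m) → Term n → Term m
  subT σ (var i) = σ i
  subT σ (fun f ts) = fun f (subTs σ ts)

  subTs : ∀ {n m} → (Fin n → Term m) → List (Term n) → List (Term m)
  subTs σ [] = []
  subTs σ (t ∷ ts) = subT σ t ∷ subTs σ ts

liftS : ∀ {n m} → (Fin n → Term m) → Fin (suc n) → Term (suc m)
liftS σ zero = var zero
liftS σ (suc i) = renT suc (σ i)

subF : ∀ {n m} → (Fin n → Term m) → Formula n → Formula m
subF σ (atom p ts) = atom p (subTs σ ts)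
subF σ (and A B) = and (subF σ A) (subF σ B)
subF σ (or A B) = or (subF σ A) (subF σ B)
subF σ (imp A B) = imp (subF σ A) (subF σ B)
subF σ (neg A) = neg (subF σ A)
subF σ (all A) = all (subF (liftS σ) A)
subF σ (ex A) = ex (subF (liftS σ) A)

_[_] : Formula 1 → Tm → Fm
A [ t ] = subF (λ _ → t) A

mutual
  symsT : ∀ {n} → Term n → List ℕ
  symsT (var i) = []
  symsT (fun f ts) = f ∷ symsTs ts

  symsTs : ∀ {n} → List (Term n) → List ℕ
  symsTs [] = []
  symsTs (t ∷ ts) = symsT t ++ symsTs ts

symsF : ∀ {n} → Formula n → List ℕ
symsF (atom p ts) = symsTs ts
symsF (and A B) = symsF A ++ symsF B
symsF (or A B) = symsF A ++ symsF B
symsF (imp A B) = symsF A ++ symsF B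
symsF (neg A) = symsF A
symsF (all A) = symsF A
symsF (ex A) = symsF A

symsL : List Fm → List ℕ
symsL [] = []
symsL (A ∷ Γ) = symsF A ++ symsL Γ

Fresh : ℕ → List Fm → List Fm → Set
Fresh c Γ Δ = ¬ (c ∈ symsL Γ) × ¬ (c ∈ symsL Δ)
  where open import Data.Product using (_×_)

-- Cut-free classical sequent calculus LK.
-- Multisets are represented by lists together with an exchange rule
-- (permutation of both sides); principal formulas are at the head.

data LK : List Fm → List Fm → Set where
  ax     : ∀ {Γ Δ A} → LK (A ∷ Γ) (A ∷ Δ)
  ∧L     : ∀ {Γ Δ A B} → LK (A ∷ B ∷ Γ) Δ → LK (and A B ∷ Γ) Δ
  ∧R     : ∀ {Γ Δ A B} → LK Γ (A ∷ Δ) → LK Γ (B ∷ Δ) → LK Γ (and A B ∷ Δ)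
  ∨L     : ∀ {Γ Δ A B} → LK (A ∷ Γ) Δ → LK (B ∷ Γ) Δ → LK (or A B ∷ Γ) Δ
  ∨R     : ∀ {Γ Δ A B} → LK Γ (A ∷ B ∷ Δ) → LK Γ (or A B ∷ Δ)
  ⇒L     : ∀ {Γ Δ A B} → LK Γ (A ∷ Δ) → LK (B ∷ Γ) Δ → LK (imp A B ∷ Γ) Δ
  ⇒R     : ∀ {Γ Δ A B} → LK (A ∷ Γ) (B ∷ Δ) → LK Γ (imp A B ∷ Δ)
  ¬L     : ∀ {Γ Δ A} → LK Γ (A ∷ Δ) → LK (neg A ∷ Γ) Δ
  ¬R     : ∀ {Γ Δ A} → LK (A ∷ Γ) Δ → LK Γ (neg A ∷ Δ)
  ∀L     : ∀ {Γ Δ A} (t : Tm) → LK (A [ t ] ∷ Γ) Δ → LK (all A ∷ Γ) Δ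
  ∀R     : ∀ {Γ Δ A} (c : ℕ) → Fresh c Γ (all A ∷ Δ) →
           LK Γ (A [ cst c ] ∷ Δ) → LK Γ (all A ∷ Δ)
  ∃L     : ∀ {Γ Δ A} (c : ℕ) → Fresh c (ex A ∷ Γ) Δ →
           LK (A [ cst c ] ∷ Γ) Δ → LK (ex A ∷ Γ) Δ
  ∃R     : ∀ {Γ Δ A} (t : Tm) → LK Γ (A [ t ] ∷ Δ) → LK Γ (ex A ∷ Δ)
  contrL : ∀ {Γ Δ A} → LK (A ∷ A ∷ Γ) Δ → LK (A ∷ Γ) Δ
  contrR : ∀ {Γ Δ A} → LK Γ (A ∷ A ∷ Δ) → LK Γ (A ∷ Δ)
  weakL  : ∀ {Γ Δ A} → LK Γ Δ → LK (A ∷ Γ) Δ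
  weakR  : ∀ {Γ Δ A} → LK Γ Δ → LK Γ (A ∷ Δ)
  exch   : ∀ {Γ Γ' Δ Δ'} → Γ ↭ Γ' → Δ ↭ Δ' → LK Γ Δ → LK Γ' Δ'

-- Focused classical sequent calculus: Γ ⊢ S ; Δ with stoup S : Maybe Fm
-- (nothing = empty stoup ".").

data Atomic : Fm → Set where
  atomic : ∀ {p ts} → Atomic (atom p ts)

data Releasable : Fm → Set where
  r-atom : ∀ {p ts} → Releasable (atom p ts)
  r-ex   : ∀ {B} → Releasable (ex B)
  r-or   : ∀ {B C} → Releasable (or B C)
  r-neg  : ∀ {B} → Releasable (neg B)

data LKF : List Fm → Maybe Fm → List Fm → Set where
  ax     : ∀ {Γ Δ A} → Atomic A → LKF (A ∷ Γ) nothing (A ∷ Δ)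
  ∧L     : ∀ {Γ Δ A B} → LKF (A ∷ B ∷ Γ) nothing Δ → LKF (and A B ∷ Γ) nothing Δ
  ∧R     : ∀ {Γ Δ A B} → LKF Γ (just A) Δ → LKF Γ (just B) Δ → LKF Γ (just (and A B)) Δ
  ∨L     : ∀ {Γ Δ A B} → LKF (A ∷ Γ) nothing Δ → LKF (B ∷ Γ) nothing Δ →
           LKF (or A B ∷ Γ) nothing Δ
  ∨R     : ∀ {Γ Δ A B} → LKF Γ nothing (A ∷ B ∷ Δ) → LKF Γ nothing (or A B ∷ Δ)
  ⇒L     : ∀ {Γ Δ A B} → LKF Γ (just A) Δ → LKF (B ∷ Γ) nothing Δ →
           LKF (imp A B ∷ Γ) nothing Δ
  ⇒R     : ∀ {Γ Δ A B} → LKF (A ∷ Γ) (just B) Δ → LKF Γ (just (imp A B)) Δ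
  ¬L     : ∀ {Γ Δ A} → LKF Γ (just A) Δ → LKF (neg A ∷ Γ) nothing Δ
  ¬R     : ∀ {Γ Δ A} → LKF (A ∷ Γ) nothing Δ → LKF Γ nothing (neg A ∷ Δ)
  ∃L     : ∀ {Γ Δ A} (c : ℕ) → Fresh c (ex A ∷ Γ) Δ →
           LKF (A [ cst c ] ∷ Γ) nothing Δ → LKF (ex A ∷ Γ) nothing Δ
  ∃R     : ∀ {Γ Δ A} (t : Tm) → LKF Γ nothing (A [ t ] ∷ Δ) → LKF Γ nothing (ex A ∷ Δ)
  ∀L     : ∀ {Γ Δ A} (t : Tm) → LKF (A [ t ] ∷ Γ) nothing Δ → LKF (all A ∷ Γ) nothing Δ
  ∀R     : ∀ {Γ Δ A} (c : ℕ) → Fresh c Γ (all A ∷ Δ) →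
           LKF Γ (just (A [ cst c ])) Δ → LKF Γ (just (all A)) Δ
  contrL : ∀ {Γ Δ A} → LKF (A ∷ A ∷ Γ) nothing Δ → LKF (A ∷ Γ) nothing Δ
  contrR : ∀ {Γ Δ A} → LKF Γ nothing (A ∷ A ∷ Δ) → LKF Γ nothing (A ∷ Δ)
  weakL  : ∀ {Γ Δ A} → LKF Γ nothing Δ → LKF (A ∷ Γ) nothing Δ
  weakR  : ∀ {Γ Δ A} → LKF Γ nothing Δ → LKF Γ (just A) Δ
  focus  : ∀ {Γ Δ A} → ¬ Releasable A → LKF Γ (just A) Δ → LKF Γ nothing (A ∷ Δ)
  release : ∀ {Γ Δ A} → Releasable A → LKF Γ nothing (A ∷ Δ) → LKF Γ (just A) Δ
  exch   : ∀ {Γ Γ' Δ Δ' S} → Γ ↭ Γ' → Δ ↭ Δ' → LKF Γ S Δ → LKF Γ' S Δ'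

_∷?_ : Maybe Fm → List Fm → List Fm
just A ∷? Δ = A ∷ Δ
nothing ∷? Δ = Δ

module Submission where

-- Translate proofs rule by rule.  Left rules and right rules for the
-- releasable connectives (∨, ¬, ∃) translate directly.  The other right rules
-- (∧, ⇒, ∀) need their principal formula in the stoup, where it is decomposed
-- by the focused rules ∧R, ⇒R, ∀R; their premises are obtained by inverting
-- the classical ∧R, ⇒R, ∀R.  Inversion preserves proof height, so the mutual
-- recursion (on height, then on the size of the stoup formula) terminates.

open import Defs
open import Data.Nat using (ℕ; suc; _+_; _≤_; _<_; s≤s; _⊔_)
open import Data.Nat.Properties
  using (_≟_; ≤-refl; ≤-trans; m≤m+n; m≤n+m; n≤1+n; m≤m⊔n; m≤n⊔m; m+n≤o⇒m≤o; 1+n≰n)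
open import Data.Fin using (Fin; zero; suc)
open import Data.List using (List; []; _∷_; _++_; map)
open import Data.Nat.ListAction using (sum)
open import Data.List.Properties using (map-++; ++-assoc)
open import Data.List.Membership.Propositional using (_∈_; _∉_)
open import Data.List.Membership.Propositional.Properties using (∈-++⁺ˡ; ∈-++⁺ʳ; ∈-++⁻)
open import Data.List.Relation.Unary.Any using (here; there)
open import Data.List.Relation.Binary.Permutation.Propositional
  using (_↭_; ↭-refl; ↭-prep; ↭-swap; ↭-trans; ↭-sym; ↭-reflexive)
open import Data.List.Relation.Binary.Permutation.Propositional.Properties
  using (∈-resp-↭; drop-∷; shift; shifts; ++⁺ˡ; ++⁺ʳ; ++⁺; map⁺; ++-commutativeMonoid)
open import Data.Maybe using (Maybe; just; nothing)
open import Data.Product using (∃; _×_; _,_; proj₂; map₂)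
open import Data.Sum using (_⊎_; inj₁; inj₂)
open import Data.Empty using (⊥-elim)
open import Relation.Nullary using (¬_; yes; no)
open import Relation.Binary.PropositionalEquality
  using (_≡_; refl; sym; trans; cong; cong₂; subst; subst₂)
open import Function using (_∘_)

-- Renaming of function symbols.  Eigenvariables are constants, i.e. nullary
-- function symbols, so exchanging an eigenvariable is such a renaming.

mutual
  renSymT : ∀ {n} → (ℕ → ℕ) → Term n → Term n
  renSymT π (var i) = var i
  renSymT π (fun f ts) = fun (π f) (renSymTs π ts)

  renSymTs : ∀ {n} → (ℕ → ℕ) → List (Term n) → List (Term n)
  renSymTs π [] = []
  renSymTs π (t ∷ ts) = renSymT π t ∷ renSymTs π ts

renSymF : ∀ {n} → (ℕ → ℕ) → Formula n → Formula n
renSymF π (atom p ts) = atom p (renSymTs π ts)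
renSymF π (and A B) = and (renSymF π A) (renSymF π B)
renSymF π (or A B) = or (renSymF π A) (renSymF π B)
renSymF π (imp A B) = imp (renSymF π A) (renSymF π B)
renSymF π (neg A) = neg (renSymF π A)
renSymF π (all A) = all (renSymF π A)
renSymF π (ex A) = ex (renSymF π A)

renSymL : (ℕ → ℕ) → List Fm → List Fm
renSymL π = map (renSymF π)

Agree : (ℕ → ℕ) → (ℕ → ℕ) → List ℕ → Set
Agree π π' L = ∀ {x} → x ∈ L → π x ≡ π' x

mutual
  renSymT-ext : ∀ {n} π π' (t : Term n) → Agree π π' (symsT t) → renSymT π t ≡ renSymT π' t
  renSymT-ext π π' (var i) h = refl
  renSymT-ext π π' (fun f ts) h = cong₂ fun (h (here refl)) (renSymTs-ext π π' ts (h ∘ there))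

  renSymTs-ext : ∀ {n} π π' (ts : List (Term n)) → Agree π π' (symsTs ts) →
                 renSymTs π ts ≡ renSymTs π' ts
  renSymTs-ext π π' [] h = refl
  renSymTs-ext π π' (t ∷ ts) h =
    cong₂ _∷_ (renSymT-ext π π' t (h ∘ ∈-++⁺ˡ)) (renSymTs-ext π π' ts (h ∘ ∈-++⁺ʳ (symsT t)))

renSymF-ext : ∀ {n} π π' (A : Formula n) → Agree π π' (symsF A) → renSymF π A ≡ renSymF π' A
renSymF-ext π π' (atom p ts) h = cong (atom p) (renSymTs-ext π π' ts h)
renSymF-ext π π' (and A B) h =
  cong₂ and (renSymF-ext π π' A (h ∘ ∈-++⁺ˡ)) (renSymF-ext π π' B (h ∘ ∈-++⁺ʳ (symsF A)))
renSymF-ext π π' (or A B) h =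
  cong₂ or (renSymF-ext π π' A (h ∘ ∈-++⁺ˡ)) (renSymF-ext π π' B (h ∘ ∈-++⁺ʳ (symsF A)))
renSymF-ext π π' (imp A B) h =
  cong₂ imp (renSymF-ext π π' A (h ∘ ∈-++⁺ˡ)) (renSymF-ext π π' B (h ∘ ∈-++⁺ʳ (symsF A)))
renSymF-ext π π' (neg A) h = cong neg (renSymF-ext π π' A h)
renSymF-ext π π' (all A) h = cong all (renSymF-ext π π' A h)
renSymF-ext π π' (ex A) h = cong ex (renSymF-ext π π' A h)

renSymL-ext : ∀ π π' (Γ : List Fm) → Agree π π' (symsL Γ) → renSymL π Γ ≡ renSymL π' Γ
renSymL-ext π π' [] h = refl
renSymL-ext π π' (A ∷ Γ) h =
  cong₂ _∷_ (renSymF-ext π π' A (h ∘ ∈-++⁺ˡ)) (renSymL-ext π π' Γ (h ∘ ∈-++⁺ʳ (symsF A)))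

mutual
  renSymT-id : ∀ {n} (t : Term n) → renSymT (λ x → x) t ≡ t
  renSymT-id (var i) = refl
  renSymT-id (fun f ts) = cong (fun f) (renSymTs-id ts)

  renSymTs-id : ∀ {n} (ts : List (Term n)) → renSymTs (λ x → x) ts ≡ ts
  renSymTs-id [] = refl
  renSymTs-id (t ∷ ts) = cong₂ _∷_ (renSymT-id t) (renSymTs-id ts)

renSymF-id : ∀ {n} (A : Formula n) → renSymF (λ x → x) A ≡ A
renSymF-id (atom p ts) = cong (atom p) (renSymTs-id ts)
renSymF-id (and A B) = cong₂ and (renSymF-id A) (renSymF-id B)
renSymF-id (or A B) = cong₂ or (renSymF-id A) (renSymF-id B)
renSymF-id (imp A B) = cong₂ imp (renSymF-id A) (renSymF-id B)
renSymF-id (neg A) = cong neg (renSymF-id A)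
renSymF-id (all A) = cong all (renSymF-id A)
renSymF-id (ex A) = cong ex (renSymF-id A)

renSymL-id : ∀ (Γ : List Fm) → renSymL (λ x → x) Γ ≡ Γ
renSymL-id [] = refl
renSymL-id (A ∷ Γ) = cong₂ _∷_ (renSymF-id A) (renSymL-id Γ)

mutual
  renSym-renT : ∀ {n m} π (ρ : Fin n → Fin m) (t : Term n) →
                renSymT π (renT ρ t) ≡ renT ρ (renSymT π t)
  renSym-renT π ρ (var i) = refl
  renSym-renT π ρ (fun f ts) = cong (fun (π f)) (renSym-renTs π ρ ts)

  renSym-renTs : ∀ {n m} π (ρ : Fin n → Fin m) (ts : List (Term n)) →
                 renSymTs π (renTs ρ ts) ≡ renTs ρ (renSymTs π ts)
  renSym-renTs π ρ [] = refl
  renSym-renTs π ρ (t ∷ ts) = cong₂ _∷_ (renSym-renT π ρ t) (renSym-renTs π ρ ts)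

mutual
  subT-ext : ∀ {n m} {σ τ : Fin n → Term m} → (∀ i → σ i ≡ τ i) → (t : Term n) → subT σ t ≡ subT τ t
  subT-ext h (var i) = h i
  subT-ext h (fun f ts) = cong (fun f) (subTs-ext h ts)

  subTs-ext : ∀ {n m} {σ τ : Fin n → Term m} → (∀ i → σ i ≡ τ i) → (ts : List (Term n)) →
              subTs σ ts ≡ subTs τ ts
  subTs-ext h [] = refl
  subTs-ext h (t ∷ ts) = cong₂ _∷_ (subT-ext h t) (subTs-ext h ts)

liftS-ext : ∀ {n m} {σ τ : Fin n → Term m} → (∀ i → σ i ≡ τ i) → ∀ i → liftS σ i ≡ liftS τ i
liftS-ext h zero = refl
liftS-ext h (suc i) = cong (renT suc) (h i)

subF-ext : ∀ {n m} {σ τ : Fin n → Term m} → (∀ i → σ i ≡ τ i) → (A : Formula n) → subF σ A ≡ subF τ A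
subF-ext h (atom p ts) = cong (atom p) (subTs-ext h ts)
subF-ext h (and A B) = cong₂ and (subF-ext h A) (subF-ext h B)
subF-ext h (or A B) = cong₂ or (subF-ext h A) (subF-ext h B)
subF-ext h (imp A B) = cong₂ imp (subF-ext h A) (subF-ext h B)
subF-ext h (neg A) = cong neg (subF-ext h A)
subF-ext h (all A) = cong all (subF-ext (liftS-ext h) A)
subF-ext h (ex A) = cong ex (subF-ext (liftS-ext h) A)

mutual
  renSym-subT : ∀ {n m} π (σ : Fin n → Term m) (t : Term n) →
                renSymT π (subT σ t) ≡ subT (renSymT π ∘ σ) (renSymT π t)
  renSym-subT π σ (var i) = refl
  renSym-subT π σ (fun f ts) = cong (fun (π f)) (renSym-subTs π σ ts)

  renSym-subTs : ∀ {n m} π (σ : Fin n → Term m) (ts : List (Term n)) →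
                 renSymTs π (subTs σ ts) ≡ subTs (renSymT π ∘ σ) (renSymTs π ts)
  renSym-subTs π σ [] = refl
  renSym-subTs π σ (t ∷ ts) = cong₂ _∷_ (renSym-subT π σ t) (renSym-subTs π σ ts)

renSym-liftS : ∀ {n m} π (σ : Fin n → Term m) i → renSymT π (liftS σ i) ≡ liftS (renSymT π ∘ σ) i
renSym-liftS π σ zero = refl
renSym-liftS π σ (suc i) = renSym-renT π suc (σ i)

renSym-subF : ∀ {n m} π (σ : Fin n → Term m) (A : Formula n) →
              renSymF π (subF σ A) ≡ subF (renSymT π ∘ σ) (renSymF π A)
renSym-subF π σ (atom p ts) = cong (atom p) (renSym-subTs π σ ts)
renSym-subF π σ (and A B) = cong₂ and (renSym-subF π σ A) (renSym-subF π σ B)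
renSym-subF π σ (or A B) = cong₂ or (renSym-subF π σ A) (renSym-subF π σ B)
renSym-subF π σ (imp A B) = cong₂ imp (renSym-subF π σ A) (renSym-subF π σ B)
renSym-subF π σ (neg A) = cong neg (renSym-subF π σ A)
renSym-subF π σ (all A) =
  cong all (trans (renSym-subF π (liftS σ) A) (subF-ext (renSym-liftS π σ) (renSymF π A)))
renSym-subF π σ (ex A) =
  cong ex (trans (renSym-subF π (liftS σ) A) (subF-ext (renSym-liftS π σ) (renSymF π A)))

renSym-inst : ∀ π (A : Formula 1) (t : Tm) → renSymF π (A [ t ]) ≡ renSymF π A [ renSymT π t ]
renSym-inst π A t = renSym-subF π (λ _ → t) A

redirect : (ℕ → ℕ) → ℕ → ℕ → ℕ → ℕ
redirect π e e' x with x ≟ e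
... | yes _ = e'
... | no _ = π x

redirect-hit : ∀ π e e' → redirect π e e' e ≡ e'
redirect-hit π e e' with e ≟ e
... | yes _ = refl
... | no e≢e = ⊥-elim (e≢e refl)

redirect-agree : ∀ π {e} e' {L} → e ∉ L → Agree (redirect π e e') π L
redirect-agree π {e} e' e∉L {x} x∈L with x ≟ e
... | yes refl = ⊥-elim (e∉L x∈L)
... | no _ = refl

redirectL : ∀ π {e} e' (Γ : List Fm) → e ∉ symsL Γ → renSymL (redirect π e e') Γ ≡ renSymL π Γ
redirectL π e' Γ e∉Γ = renSymL-ext _ _ Γ (redirect-agree π e' e∉Γ)

redirect-inst : ∀ π {e} e' (A : Formula 1) → e ∉ symsF A →
                renSymF (redirect π e e') (A [ cst e ]) ≡ renSymF π A [ cst e' ]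
redirect-inst π {e} e' A e∉A =
  trans (renSym-inst (redirect π e e') A (cst e))
        (cong₂ (λ B c → B [ cst c ]) (renSymF-ext _ _ A (redirect-agree π e' e∉A)) (redirect-hit π e e'))

-- every element is bounded by the sum, so the
-- successor of the sum is a fresh symbol
∈⇒≤sum : ∀ {x xs} → x ∈ xs → x ≤ sum xs
∈⇒≤sum {xs = y ∷ ys} (here refl) = m≤m+n y (sum ys)
∈⇒≤sum {xs = y ∷ ys} (there x∈ys) = ≤-trans (∈⇒≤sum x∈ys) (m≤n+m (sum ys) y)

fresh : List ℕ → ℕ
fresh xs = suc (sum xs)

fresh-∉ : ∀ xs → fresh xs ∉ xs
fresh-∉ xs = 1+n≰n ∘ ∈⇒≤sum

freshFor : (Γ Δ : List Fm) → ∃ λ c → Fresh c Γ Δ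
freshFor Γ Δ = fresh K , fresh-∉ K ∘ ∈-++⁺ˡ , fresh-∉ K ∘ ∈-++⁺ʳ (symsL Γ)
  where K = symsL Γ ++ symsL Δ

size : ∀ {n} → Formula n → ℕ
size (atom p ts) = 0
size (and A B) = suc (size A + size B)
size (or A B) = suc (size A + size B)
size (imp A B) = suc (size A + size B)
size (neg A) = suc (size A)
size (all A) = suc (size A)
size (ex A) = suc (size A)

size-subF : ∀ {n m} (σ : Fin n → Term m) (A : Formula n) → size (subF σ A) ≡ size A
size-subF σ (atom p ts) = refl
size-subF σ (and A B) = cong₂ (λ a b → suc (a + b)) (size-subF σ A) (size-subF σ B)
size-subF σ (or A B) = cong₂ (λ a b → suc (a + b)) (size-subF σ A) (size-subF σ B)
size-subF σ (imp A B) = cong₂ (λ a b → suc (a + b)) (size-subF σ A) (size-subF σ B)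
size-subF σ (neg A) = cong suc (size-subF σ A)
size-subF σ (all A) = cong suc (size-subF (liftS σ) A)
size-subF σ (ex A) = cong suc (size-subF (liftS σ) A)

size-inst : ∀ (A : Formula 1) t {s} → size A < s → size (A [ t ]) < s
size-inst A t {s} h = subst (_< s) (sym (size-subF (λ _ → t) A)) h

size-left : ∀ {a b s} → a + b < s → a < s
size-left {a} h = m+n≤o⇒m≤o (suc a) h

size-right : ∀ {a b s} → a + b < s → b < s
size-right {a} {b} h = ≤-trans (s≤s (m≤n+m b a)) h

module _ {X : Set} where

  open import Algebra.Solver.CommutativeMonoid (++-commutativeMonoid {A = X})

  doubled-swap : ∀ (U V W : List X) → U ++ V ++ V ++ W ↭ V ++ V ++ U ++ W
  doubled-swap U V W =
    solve 3 (λ u v w → u ⊕ (v ⊕ (v ⊕ w)) ⊜ v ⊕ (v ⊕ (u ⊕ w))) ↭-refl U V W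

  doubled-merge : ∀ (U V W : List X) → U ++ U ++ V ++ V ++ W ↭ (U ++ V) ++ (U ++ V) ++ W
  doubled-merge U V W =
    solve 3 (λ u v w → u ⊕ (u ⊕ (v ⊕ (v ⊕ w))) ⊜ (u ⊕ v) ⊕ ((u ⊕ v) ⊕ w)) ↭-refl U V W

  ∈⇒↭ : ∀ {x : X} {xs} → x ∈ xs → ∃ λ ys → xs ↭ x ∷ ys
  ∈⇒↭ {xs = y ∷ ys} (here refl) = ys , ↭-refl
  ∈⇒↭ {x} {xs = y ∷ ys} (there x∈ys) with ∈⇒↭ x∈ys
  ... | zs , p = y ∷ zs , ↭-trans (↭-prep y p) (↭-swap y x ↭-refl)

  split : ∀ {p r : X} {ps rs} → p ∷ ps ↭ r ∷ rs →
          (p ≡ r × ps ↭ rs) ⊎ ∃ λ qs → ps ↭ r ∷ qs × rs ↭ p ∷ qs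
  split {p} {r} {ps} {rs} eq with ∈-resp-↭ (↭-sym eq) (here refl)
  ... | here refl = inj₁ (refl , drop-∷ eq)
  ... | there r∈ps with ∈⇒↭ r∈ps
  ...   | qs , ps↭ = inj₂ (qs , ps↭ , drop-∷ (↭-trans (↭-sym eq) (↭-trans (↭-prep p ps↭) (↭-swap p r ↭-refl))))

  split++ : ∀ {r : X} us {vs rs} → us ++ vs ↭ r ∷ rs →
            (∃ λ us' → us ↭ r ∷ us' × rs ↭ us' ++ vs) ⊎ (∃ λ vs' → vs ↭ r ∷ vs' × rs ↭ us ++ vs')
  split++ {r} us {vs} eq with ∈-++⁻ us (∈-resp-↭ (↭-sym eq) (here refl))
  ... | inj₁ r∈us with ∈⇒↭ r∈us
  ...   | us' , p = inj₁ (us' , p , drop-∷ (↭-trans (↭-sym eq) (++⁺ʳ vs p)))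
  split++ {r} us {vs} eq | inj₂ r∈vs with ∈⇒↭ r∈vs
  ...   | vs' , p = inj₂ (vs' , p , drop-∷ (↭-trans (↭-sym eq) (↭-trans (++⁺ˡ us p) (shift r us vs'))))

  pushR : ∀ {r : X} us {vs vs'} → vs ↭ r ∷ vs' → us ++ vs ↭ r ∷ us ++ vs'
  pushR {r} us {vs' = vs'} p = ↭-trans (++⁺ˡ us p) (shift r us vs')

-- LKh: LK with explicit heights (a derivation in LKh n has height at most n),
-- atomic axioms, contraction of whole blocks of formulas, and no weakening
-- rule.  LKF has only atomic axioms and cannot weaken the right side when the
-- stoup is empty, so weakening is pushed into the axioms (see `weaken`).
-- Contracting whole blocks keeps the inversion lemmas height-preserving.

data LKh : ℕ → List Fm → List Fm → Set where
  ax     : ∀ {n Γ Δ A} → Atomic A → LKh n (A ∷ Γ) (A ∷ Δ)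
  ∧L     : ∀ {n Γ Δ A B} → LKh n (A ∷ B ∷ Γ) Δ → LKh (suc n) (and A B ∷ Γ) Δ
  ∧R     : ∀ {n Γ Δ A B} → LKh n Γ (A ∷ Δ) → LKh n Γ (B ∷ Δ) → LKh (suc n) Γ (and A B ∷ Δ)
  ∨L     : ∀ {n Γ Δ A B} → LKh n (A ∷ Γ) Δ → LKh n (B ∷ Γ) Δ → LKh (suc n) (or A B ∷ Γ) Δ
  ∨R     : ∀ {n Γ Δ A B} → LKh n Γ (A ∷ B ∷ Δ) → LKh (suc n) Γ (or A B ∷ Δ)
  ⇒L     : ∀ {n Γ Δ A B} → LKh n Γ (A ∷ Δ) → LKh n (B ∷ Γ) Δ → LKh (suc n) (imp A B ∷ Γ) Δ
  ⇒R     : ∀ {n Γ Δ A B} → LKh n (A ∷ Γ) (B ∷ Δ) → LKh (suc n) Γ (imp A B ∷ Δ)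
  ¬L     : ∀ {n Γ Δ A} → LKh n Γ (A ∷ Δ) → LKh (suc n) (neg A ∷ Γ) Δ
  ¬R     : ∀ {n Γ Δ A} → LKh n (A ∷ Γ) Δ → LKh (suc n) Γ (neg A ∷ Δ)
  ∀L     : ∀ {n Γ Δ A} (t : Tm) → LKh n (A [ t ] ∷ Γ) Δ → LKh (suc n) (all A ∷ Γ) Δ
  ∀R     : ∀ {n Γ Δ A} (c : ℕ) → Fresh c Γ (all A ∷ Δ) →
           LKh n Γ (A [ cst c ] ∷ Δ) → LKh (suc n) Γ (all A ∷ Δ)
  ∃L     : ∀ {n Γ Δ A} (c : ℕ) → Fresh c (ex A ∷ Γ) Δ →
           LKh n (A [ cst c ] ∷ Γ) Δ → LKh (suc n) (ex A ∷ Γ) Δ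
  ∃R     : ∀ {n Γ Δ A} (t : Tm) → LKh n Γ (A [ t ] ∷ Δ) → LKh (suc n) Γ (ex A ∷ Δ)
  ctr    : ∀ {n Γ Δ} Γc Δc → LKh n (Γc ++ Γc ++ Γ) (Δc ++ Δc ++ Δ) → LKh (suc n) (Γc ++ Γ) (Δc ++ Δ)
  exch   : ∀ {n Γ Γ' Δ Δ'} → Γ ↭ Γ' → Δ ↭ Δ' → LKh n Γ Δ → LKh n Γ' Δ'

raise : ∀ {m n Γ Δ} → m ≤ n → LKh m Γ Δ → LKh n Γ Δ
raise m≤n (ax a) = ax a
raise (s≤s m≤n) (∧L d) = ∧L (raise m≤n d)
raise (s≤s m≤n) (∧R d e) = ∧R (raise m≤n d) (raise m≤n e)
raise (s≤s m≤n) (∨L d e) = ∨L (raise m≤n d) (raise m≤n e)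
raise (s≤s m≤n) (∨R d) = ∨R (raise m≤n d)
raise (s≤s m≤n) (⇒L d e) = ⇒L (raise m≤n d) (raise m≤n e)
raise (s≤s m≤n) (⇒R d) = ⇒R (raise m≤n d)
raise (s≤s m≤n) (¬L d) = ¬L (raise m≤n d)
raise (s≤s m≤n) (¬R d) = ¬R (raise m≤n d)
raise (s≤s m≤n) (∀L t d) = ∀L t (raise m≤n d)
raise (s≤s m≤n) (∀R c f d) = ∀R c f (raise m≤n d)
raise (s≤s m≤n) (∃L c f d) = ∃L c f (raise m≤n d)
raise (s≤s m≤n) (∃R t d) = ∃R t (raise m≤n d)
raise (s≤s m≤n) (ctr Γc Δc d) = ctr Γc Δc (raise m≤n d)
raise m≤n (exch p q d) = exch p q (raise m≤n d)

exchL : ∀ {n Γ Γ' Δ} → Γ ↭ Γ' → LKh n Γ Δ → LKh n Γ' Δ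
exchL p = exch p ↭-refl

exchR : ∀ {n Γ Δ Δ'} → Δ ↭ Δ' → LKh n Γ Δ → LKh n Γ Δ'
exchR q = exch ↭-refl q

frontL : ∀ {n} X {A Γ Δ} → LKh n (X ++ A ∷ Γ) Δ → LKh n (A ∷ X ++ Γ) Δ
frontL X {A} {Γ} = exchL (shift A X Γ)

unfrontL : ∀ {n} X {A Γ Δ} → LKh n (A ∷ X ++ Γ) Δ → LKh n (X ++ A ∷ Γ) Δ
unfrontL X {A} {Γ} = exchL (↭-sym (shift A X Γ))

frontR : ∀ {n} X {A Γ Δ} → LKh n Γ (X ++ A ∷ Δ) → LKh n Γ (A ∷ X ++ Δ)
frontR X {A} {Δ = Δ} = exchR (shift A X Δ)

unfrontR : ∀ {n Γ} X {P Δ' Δ₀} → Δ₀ ↭ P ∷ Δ' → LKh n Γ (P ∷ X ++ Δ') → LKh n Γ (X ++ Δ₀)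
unfrontR X {P} {Δ'} q = exchR (↭-trans (↭-sym (shift P X Δ')) (++⁺ˡ X (↭-sym q)))

∃L-fresh : ∀ {n Γ Δ A} → (∀ c → LKh n (A [ cst c ] ∷ Γ) Δ) → LKh (suc n) (ex A ∷ Γ) Δ
∃L-fresh {Γ = Γ} {Δ} {A} d with freshFor (ex A ∷ Γ) Δ
... | c , f = ∃L c f (d c)

∀R-fresh : ∀ {n Γ Δ A} → (∀ c → LKh n Γ (A [ cst c ] ∷ Δ)) → LKh (suc n) Γ (all A ∷ Δ)
∀R-fresh {Γ = Γ} {Δ} {A} d with freshFor Γ (all A ∷ Δ)
... | c , f = ∀R c f (d c)

-- renaming function symbols in a whole derivation; eigenvariables are
-- re-chosen fresh, so that the side conditions survive the renaming
rename : ∀ {n Γ Δ} π → LKh n Γ Δ → LKh n (renSymL π Γ) (renSymL π Δ)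
rename π (ax atomic) = ax atomic
rename π (∧L d) = ∧L (rename π d)
rename π (∧R d e) = ∧R (rename π d) (rename π e)
rename π (∨L d e) = ∨L (rename π d) (rename π e)
rename π (∨R d) = ∨R (rename π d)
rename π (⇒L d e) = ⇒L (rename π d) (rename π e)
rename π (⇒R d) = ⇒R (rename π d)
rename π (¬L d) = ¬L (rename π d)
rename π (¬R d) = ¬R (rename π d)
rename π (∀L {Γ = Γ} {Δ} {A} t d) =
  ∀L (renSymT π t) (subst (λ B → LKh _ (B ∷ renSymL π Γ) (renSymL π Δ)) (renSym-inst π A t) (rename π d))
rename π (∃R {Γ = Γ} {Δ} {A} t d) =
  ∃R (renSymT π t) (subst (λ B → LKh _ (renSymL π Γ) (B ∷ renSymL π Δ)) (renSym-inst π A t) (rename π d))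
rename π (∀R {Γ = Γ} {Δ} {A} e (e∉Γ , e∉AΔ) d) = ∀R-fresh λ c →
  subst₂ (LKh _) (redirectL π c Γ e∉Γ)
                 (cong₂ _∷_ (redirect-inst π c A (e∉AΔ ∘ ∈-++⁺ˡ))
                            (redirectL π c Δ (e∉AΔ ∘ ∈-++⁺ʳ (symsF A))))
                 (rename (redirect π e c) d)
rename π (∃L {Γ = Γ} {Δ} {A} e (e∉AΓ , e∉Δ) d) = ∃L-fresh λ c →
  subst₂ (LKh _) (cong₂ _∷_ (redirect-inst π c A (e∉AΓ ∘ ∈-++⁺ˡ))
                            (redirectL π c Γ (e∉AΓ ∘ ∈-++⁺ʳ (symsF A))))
                 (redirectL π c Δ e∉Δ)
                 (rename (redirect π e c) d)
rename π (ctr {Γ = Γ} {Δ} Γc Δc d) =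
  subst₂ (LKh _) (sym (map-++ _ Γc Γ)) (sym (map-++ _ Δc Δ))
    (ctr (renSymL π Γc) (renSymL π Δc) (subst₂ (LKh _) (doubled Γc Γ) (doubled Δc Δ) (rename π d)))
  where
  doubled : ∀ X Y → renSymL π (X ++ X ++ Y) ≡ renSymL π X ++ renSymL π X ++ renSymL π Y
  doubled X Y = trans (map-++ _ X (X ++ Y)) (cong (renSymL π X ++_) (map-++ _ X Y))
rename π (exch p q d) = exch (map⁺ (renSymF π) p) (map⁺ (renSymF π) q) (rename π d)

replace-fresh : ∀ {e} c (Γ : List Fm) → e ∉ symsL Γ → renSymL (redirect (λ x → x) e c) Γ ≡ Γ
replace-fresh c Γ e∉Γ = trans (redirectL _ c Γ e∉Γ) (renSymL-id Γ)

replace-inst : ∀ {e} c (A : Formula 1) → e ∉ symsF A →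
               renSymF (redirect (λ x → x) e c) (A [ cst e ]) ≡ A [ cst c ]
replace-inst c A e∉A = trans (redirect-inst _ c A e∉A) (cong (_[ cst c ]) (renSymF-id A))

changeEigR : ∀ {n Γ Δ A} e c → Fresh e Γ (all A ∷ Δ) →
         LKh n Γ (A [ cst e ] ∷ Δ) → LKh n Γ (A [ cst c ] ∷ Δ)
changeEigR {Γ = Γ} {Δ} {A} e c (e∉Γ , e∉AΔ) d =
  subst₂ (LKh _) (replace-fresh c Γ e∉Γ)
                 (cong₂ _∷_ (replace-inst c A (e∉AΔ ∘ ∈-++⁺ˡ)) (replace-fresh c Δ (e∉AΔ ∘ ∈-++⁺ʳ (symsF A))))
                 (rename (redirect (λ x → x) e c) d)

changeEigL : ∀ {n Γ Δ A} e c → Fresh e (ex A ∷ Γ) Δ →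
         LKh n (A [ cst e ] ∷ Γ) Δ → LKh n (A [ cst c ] ∷ Γ) Δ
changeEigL {Γ = Γ} {Δ} {A} e c (e∉AΓ , e∉Δ) d =
  subst₂ (LKh _) (cong₂ _∷_ (replace-inst c A (e∉AΓ ∘ ∈-++⁺ˡ)) (replace-fresh c Γ (e∉AΓ ∘ ∈-++⁺ʳ (symsF A))))
                 (replace-fresh c Δ e∉Δ)
                 (rename (redirect (λ x → x) e c) d)

weaken : ∀ n Γw Δw {Γ Δ} → LKh n Γ Δ → LKh n (Γw ++ Γ) (Δw ++ Δ)
weaken n Γw Δw (ax a) = unfrontL Γw (unfrontR Δw ↭-refl (ax a))
weaken (suc m) Γw Δw (∧L d) = unfrontL Γw (∧L (exchL (shifts Γw (_ ∷ _ ∷ [])) (weaken m Γw Δw d)))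
weaken (suc m) Γw Δw (∨L d e) = unfrontL Γw (∨L (frontL Γw (weaken m Γw Δw d)) (frontL Γw (weaken m Γw Δw e)))
weaken (suc m) Γw Δw (⇒L d e) = unfrontL Γw (⇒L (frontR Δw (weaken m Γw Δw d)) (frontL Γw (weaken m Γw Δw e)))
weaken (suc m) Γw Δw (¬L d) = unfrontL Γw (¬L (frontR Δw (weaken m Γw Δw d)))
weaken (suc m) Γw Δw (∀L t d) = unfrontL Γw (∀L t (frontL Γw (weaken m Γw Δw d)))
weaken (suc m) Γw Δw (∃L e f d) = unfrontL Γw (∃L-fresh λ c → frontL Γw (weaken m Γw Δw (changeEigL e c f d)))
weaken (suc m) Γw Δw (∧R d e) = unfrontR Δw ↭-refl (∧R (frontR Δw (weaken m Γw Δw d)) (frontR Δw (weaken m Γw Δw e)))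
weaken (suc m) Γw Δw (∨R d) = unfrontR Δw ↭-refl (∨R (exchR (shifts Δw (_ ∷ _ ∷ [])) (weaken m Γw Δw d)))
weaken (suc m) Γw Δw (⇒R d) = unfrontR Δw ↭-refl (⇒R (frontL Γw (frontR Δw (weaken m Γw Δw d))))
weaken (suc m) Γw Δw (¬R d) = unfrontR Δw ↭-refl (¬R (frontL Γw (weaken m Γw Δw d)))
weaken (suc m) Γw Δw (∀R e f d) = unfrontR Δw ↭-refl (∀R-fresh λ c → frontR Δw (weaken m Γw Δw (changeEigR e c f d)))
weaken (suc m) Γw Δw (∃R t d) = unfrontR Δw ↭-refl (∃R t (frontR Δw (weaken m Γw Δw d)))
weaken (suc m) Γw Δw (ctr {Γ = Γ} {Δ} Γc Δc d) =
  exch (shifts Γc Γw) (shifts Δc Δw)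
    (ctr Γc Δc (exch (doubled-swap Γw Γc Γ) (doubled-swap Δw Δc Δ) (weaken m Γw Δw d)))
weaken n Γw Δw (exch p q d) = exch (++⁺ˡ Γw p) (++⁺ˡ Δw q) (weaken n Γw Δw d)

Derivable : List Fm → List Fm → Set
Derivable Γ Δ = ∃ λ n → LKh n Γ Δ

rule₁ : ∀ {Γ₁ Δ₁ Γ Δ} → (∀ {n} → LKh n Γ₁ Δ₁ → LKh (suc n) Γ Δ) → Derivable Γ₁ Δ₁ → Derivable Γ Δ
rule₁ r (n , d) = suc n , r d

rule₂ : ∀ {Γ₁ Δ₁ Γ₂ Δ₂ Γ Δ} → (∀ {n} → LKh n Γ₁ Δ₁ → LKh n Γ₂ Δ₂ → LKh (suc n) Γ Δ) →
        Derivable Γ₁ Δ₁ → Derivable Γ₂ Δ₂ → Derivable Γ Δ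
rule₂ r (m , d) (n , e) = suc (m ⊔ n) , r (raise (m≤m⊔n m n) d) (raise (m≤n⊔m m n) e)

identity : ∀ s (A : Fm) → size A < s → ∀ Γ Δ → Derivable (A ∷ Γ) (A ∷ Δ)
identity (suc s) (atom p ts) _ Γ Δ = 0 , ax atomic
identity (suc s) (and A B) (s≤s h) Γ Δ =
  rule₁ ∧L (rule₂ ∧R (identity s A (size-left h) (B ∷ Γ) Δ)
                     (map₂ (exchL (↭-swap B A ↭-refl)) (identity s B (size-right h) (A ∷ Γ) Δ)))
identity (suc s) (or A B) (s≤s h) Γ Δ =
  rule₂ ∨L (rule₁ ∨R (identity s A (size-left h) Γ (B ∷ Δ)))
           (rule₁ ∨R (map₂ (exchR (↭-swap B A ↭-refl)) (identity s B (size-right h) Γ (A ∷ Δ))))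
identity (suc s) (imp A B) (s≤s h) Γ Δ =
  rule₁ (λ d → ⇒R (exchL (↭-swap _ _ ↭-refl) d))
        (rule₂ ⇒L (identity s A (size-left h) Γ (B ∷ Δ)) (identity s B (size-right h) (A ∷ Γ) Δ))
identity (suc s) (neg A) (s≤s h) Γ Δ =
  rule₁ (λ d → ¬R (exchL (↭-swap _ _ ↭-refl) d)) (rule₁ ¬L (identity s A h Γ Δ))
identity (suc s) (all A) (s≤s h) Γ Δ with freshFor (all A ∷ Γ) (all A ∷ Δ)
... | c , f = rule₁ (∀R c f) (rule₁ (∀L (cst c)) (identity s (A [ cst c ]) (size-inst A (cst c) h) Γ Δ))
identity (suc s) (ex A) (s≤s h) Γ Δ with freshFor (ex A ∷ Γ) (ex A ∷ Δ)
... | c , f = rule₁ (∃L c f) (rule₁ (∃R (cst c)) (identity s (A [ cst c ]) (size-inst A (cst c) h) Γ Δ))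

fromLK : ∀ {Γ Δ} → LK Γ Δ → Derivable Γ Δ
fromLK (ax {Γ} {Δ} {A}) = identity (suc (size A)) A ≤-refl Γ Δ
fromLK (∧L d) = rule₁ ∧L (fromLK d)
fromLK (∧R d e) = rule₂ ∧R (fromLK d) (fromLK e)
fromLK (∨L d e) = rule₂ ∨L (fromLK d) (fromLK e)
fromLK (∨R d) = rule₁ ∨R (fromLK d)
fromLK (⇒L d e) = rule₂ ⇒L (fromLK d) (fromLK e)
fromLK (⇒R d) = rule₁ ⇒R (fromLK d)
fromLK (¬L d) = rule₁ ¬L (fromLK d)
fromLK (¬R d) = rule₁ ¬R (fromLK d)
fromLK (∀L t d) = rule₁ (∀L t) (fromLK d)
fromLK (∀R c f d) = rule₁ (∀R c f) (fromLK d)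
fromLK (∃L c f d) = rule₁ (∃L c f) (fromLK d)
fromLK (∃R t d) = rule₁ (∃R t) (fromLK d)
fromLK (contrL {A = A} d) = rule₁ (ctr (A ∷ []) []) (fromLK d)
fromLK (contrR {A = A} d) = rule₁ (ctr [] (A ∷ [])) (fromLK d)
fromLK (weakL {A = A} d) = let n , e = fromLK d in n , weaken n (A ∷ []) [] e
fromLK (weakR {A = A} d) = let n , e = fromLK d in n , weaken n [] (A ∷ []) e
fromLK (exch p q d) = map₂ (exch p q) (fromLK d)

data Premises (n : ℕ) (Γ : List Fm) : Fm → List Fm → Set where
  and-prem : ∀ {Δ A B} → LKh n Γ (A ∷ Δ) → LKh n Γ (B ∷ Δ) → Premises n Γ (and A B) Δ
  or-prem  : ∀ {Δ A B} → LKh n Γ (A ∷ B ∷ Δ) → Premises n Γ (or A B) Δ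
  imp-prem : ∀ {Δ A B} → LKh n (A ∷ Γ) (B ∷ Δ) → Premises n Γ (imp A B) Δ
  neg-prem : ∀ {Δ A} → LKh n (A ∷ Γ) Δ → Premises n Γ (neg A) Δ
  all-prem : ∀ {Δ A} e → Fresh e Γ (all A ∷ Δ) → LKh n Γ (A [ cst e ] ∷ Δ) → Premises n Γ (all A) Δ
  ex-prem  : ∀ {Δ A} (t : Tm) → LKh n Γ (A [ t ] ∷ Δ) → Premises n Γ (ex A) Δ

-- Suppose that from the premises of a right rule
-- introducing the non-atomic formula R one gets, at the same height, the
-- conclusion with R replaced by the formulas L on the left and Rs on the right.
-- Then this replacement is possible in every derivation, without increasing
-- its height: the occurrence of R is traced up to where it is introduced.
module Inversion (R : Fm) (R-nonatomic : ¬ Atomic R) (L Rs : List Fm)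
                 (extract : ∀ {m Γ Δ} → Premises m Γ R Δ → LKh m (L ++ Γ) (Rs ++ Δ)) where

  -- A right rule with principal formula P: either P is the traced occurrence
  -- of R, whose premises are handled by extract, or R lies in the side
  -- context Δr, and the rule is reapplied after inverting its premises.
  rightRule : ∀ {m Γ P Δr Δ₀} → P ∷ Δr ↭ R ∷ Δ₀ → Premises m Γ P Δr →
              (∀ {Δ′} → Δr ↭ R ∷ Δ′ → LKh (suc m) (L ++ Γ) (P ∷ Rs ++ Δ′)) →
              LKh (suc m) (L ++ Γ) (Rs ++ Δ₀)
  rightRule p prem commute with split p
  ... | inj₁ (refl , q) = exchR (++⁺ˡ Rs q) (raise (n≤1+n _) (extract prem))
  ... | inj₂ (_ , p′ , q) = unfrontR Rs q (commute p′)

  mutual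
    invert : ∀ n {Γ Δ Δ₀} → Δ ↭ R ∷ Δ₀ → LKh n Γ Δ → LKh n (L ++ Γ) (Rs ++ Δ₀)
    invert n p (ax a) with split p
    ... | inj₁ (refl , _) = ⊥-elim (R-nonatomic a)
    ... | inj₂ (_ , _ , q) = unfrontL L (unfrontR Rs q (ax a))
    invert (suc m) p (∧L d) = unfrontL L (∧L (exchL (shifts L (_ ∷ _ ∷ [])) (invert m p d)))
    invert (suc m) p (∨L d e) = unfrontL L (∨L (frontL L (invert m p d)) (frontL L (invert m p e)))
    invert (suc m) p (⇒L d e) =
      unfrontL L (⇒L (frontR Rs (invert m (pushR (_ ∷ []) p) d)) (frontL L (invert m p e)))
    invert (suc m) p (¬L d) = unfrontL L (¬L (frontR Rs (invert m (pushR (_ ∷ []) p) d)))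
    invert (suc m) p (∀L t d) = unfrontL L (∀L t (frontL L (invert m p d)))
    invert (suc m) p (∃L e f d) = unfrontL L (∃L-fresh λ c → frontL L (invert m p (changeEigL e c f d)))
    invert (suc m) p (∧R d e) = rightRule p (and-prem d e) λ p′ →
      ∧R (frontR Rs (invert m (pushR (_ ∷ []) p′) d)) (frontR Rs (invert m (pushR (_ ∷ []) p′) e))
    invert (suc m) p (∨R d) = rightRule p (or-prem d) λ p′ →
      ∨R (exchR (shifts Rs (_ ∷ _ ∷ [])) (invert m (pushR (_ ∷ _ ∷ []) p′) d))
    invert (suc m) p (⇒R d) = rightRule p (imp-prem d) λ p′ →
      ⇒R (frontL L (frontR Rs (invert m (pushR (_ ∷ []) p′) d)))
    invert (suc m) p (¬R d) = rightRule p (neg-prem d) λ p′ →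
      ¬R (frontL L (invert m p′ d))
    invert (suc m) p (∀R e f d) = rightRule p (all-prem e f d) λ p′ →
      ∀R-fresh λ c → frontR Rs (invert m (pushR (_ ∷ []) p′) (changeEigR e c f d))
    invert (suc m) p (∃R t d) = rightRule p (ex-prem t d) λ p′ →
      ∃R t (frontR Rs (invert m (pushR (_ ∷ []) p′) d))
    invert (suc m) p (ctr Γc Δc d) = invertCtr m Γc Δc p d
    invert n p (exch p₁ p₂ d) = exchL (++⁺ˡ L p₁) (invert n (↭-trans p₂ p) d)

    -- R is either one of the contracted formulas (then invert it twice and
    -- contract L and Rs as well) or lies in the remaining context
    invertCtr : ∀ m {Γ Δ Δ₀} Γc Δc → Δc ++ Δ ↭ R ∷ Δ₀ →
                LKh m (Γc ++ Γc ++ Γ) (Δc ++ Δc ++ Δ) → LKh (suc m) (L ++ Γc ++ Γ) (Rs ++ Δ₀)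
    invertCtr m {Γ} {Δ} Γc Δc p d with split++ Δc p
    ... | inj₁ (Δc′ , p′ , q) =
      exch (↭-reflexive (++-assoc L Γc Γ)) (↭-trans (↭-reflexive (++-assoc Rs Δc′ Δ)) (++⁺ˡ Rs (↭-sym q)))
        (ctr (L ++ Γc) (Rs ++ Δc′) (exch (doubled-merge L Γc Γ) (doubled-merge Rs Δc′ Δ)
          (invert m (shift R Rs _) (invert m twice d))))
      where
      twice : Δc ++ Δc ++ Δ ↭ R ∷ R ∷ Δc′ ++ Δc′ ++ Δ
      twice = ↭-trans (++⁺ p′ (++⁺ʳ Δ p′)) (↭-prep R (shift R Δc′ (Δc′ ++ Δ)))
    ... | inj₂ (Δ′ , p′ , q) =
      exch (shifts Γc L) (↭-trans (shifts Δc Rs) (++⁺ˡ Rs (↭-sym q)))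
        (ctr Γc Δc (exch (doubled-swap L Γc Γ) (doubled-swap Rs Δc Δ′)
          (invert m (pushR Δc (pushR Δc p′)) d)))

invAnd₁ : ∀ {n Γ Δ A B} → LKh n Γ (and A B ∷ Δ) → LKh n Γ (A ∷ Δ)
invAnd₁ {n} {A = A} {B} =
  Inversion.invert (and A B) (λ ()) [] (A ∷ []) (λ { (and-prem d e) → d }) n ↭-refl

invAnd₂ : ∀ {n Γ Δ A B} → LKh n Γ (and A B ∷ Δ) → LKh n Γ (B ∷ Δ)
invAnd₂ {n} {A = A} {B} =
  Inversion.invert (and A B) (λ ()) [] (B ∷ []) (λ { (and-prem d e) → e }) n ↭-refl

invImp : ∀ {n Γ Δ A B} → LKh n Γ (imp A B ∷ Δ) → LKh n (A ∷ Γ) (B ∷ Δ)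
invImp {n} {A = A} {B} =
  Inversion.invert (imp A B) (λ ()) (A ∷ []) (B ∷ []) (λ { (imp-prem d) → d }) n ↭-refl

invAll : ∀ {n Γ Δ A} c → LKh n Γ (all A ∷ Δ) → LKh n Γ (A [ cst c ] ∷ Δ)
invAll {n} {A = A} c =
  Inversion.invert (all A) (λ ()) [] (A [ cst c ] ∷ []) (λ { (all-prem e f d) → changeEigR e c f d }) n ↭-refl

contractL : ∀ Γc {Γ Δ} → LKF (Γc ++ Γc ++ Γ) nothing Δ → LKF (Γc ++ Γ) nothing Δ
contractL [] d = d
contractL (A ∷ Γc) {Γ} d =
  exch (shift A Γc Γ) ↭-refl (contractL Γc (exch (doubled-swap (A ∷ []) Γc Γ) ↭-refl
    (contrL (exch (↭-sym (doubled-merge (A ∷ []) Γc Γ)) ↭-refl d))))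

contractR : ∀ Δc {Γ Δ} → LKF Γ nothing (Δc ++ Δc ++ Δ) → LKF Γ nothing (Δc ++ Δ)
contractR [] d = d
contractR (A ∷ Δc) {Δ = Δ} d =
  exch ↭-refl (shift A Δc Δ) (contractR Δc (exch ↭-refl (doubled-swap (A ∷ []) Δc Δ)
    (contrR (exch ↭-refl (↭-sym (doubled-merge (A ∷ []) Δc Δ)) d))))

-- The translation, by recursion on the height and, for a formula in the stoup,
-- on its size.  A negative formula in the stoup is decomposed using the
-- inversion lemmas, which keep the height; any other formula is released.
mutual
  unfocused : ∀ n {Γ Δ} → LKh n Γ Δ → LKF Γ nothing Δ
  unfocused n (ax a) = ax a
  unfocused (suc m) (∧L d) = ∧L (unfocused m d)
  unfocused (suc m) (∨L d e) = ∨L (unfocused m d) (unfocused m e)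
  unfocused (suc m) (⇒L d e) = ⇒L (inStoup m _ d) (unfocused m e)
  unfocused (suc m) (¬L d) = ¬L (inStoup m _ d)
  unfocused (suc m) (∀L t d) = ∀L t (unfocused m d)
  unfocused (suc m) (∃L c f d) = ∃L c f (unfocused m d)
  unfocused (suc m) (∧R d e) = focus (λ ()) (∧R (inStoup m _ d) (inStoup m _ e))
  unfocused (suc m) (∨R d) = ∨R (unfocused m d)
  unfocused (suc m) (⇒R d) = focus (λ ()) (⇒R (inStoup m _ d))
  unfocused (suc m) (¬R d) = ¬R (unfocused m d)
  unfocused (suc m) (∀R c f d) = focus (λ ()) (∀R c f (inStoup m _ d))
  unfocused (suc m) (∃R t d) = ∃R t (unfocused m d)
  unfocused (suc m) (ctr Γc Δc d) = contractL Γc (contractR Δc (unfocused m d))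
  unfocused n (exch p q d) = exch p q (unfocused n d)

  inStoup : ∀ n {Γ Δ} B → LKh n Γ (B ∷ Δ) → LKF Γ (just B) Δ
  inStoup n B = inStoup< n (suc (size B)) B ≤-refl

  inStoup< : ∀ n s {Γ Δ} B → size B < s → LKh n Γ (B ∷ Δ) → LKF Γ (just B) Δ
  inStoup< n (suc s) (atom p ts) _ d = release r-atom (unfocused n d)
  inStoup< n (suc s) (or A B) _ d = release r-or (unfocused n d)
  inStoup< n (suc s) (neg A) _ d = release r-neg (unfocused n d)
  inStoup< n (suc s) (ex A) _ d = release r-ex (unfocused n d)
  inStoup< n (suc s) (and A B) (s≤s h) d =
    ∧R (inStoup< n s A (size-left h) (invAnd₁ d)) (inStoup< n s B (size-right h) (invAnd₂ d))
  inStoup< n (suc s) (imp A B) (s≤s h) d = ⇒R (inStoup< n s B (size-right h) (invImp d))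
  inStoup< n (suc s) {Γ} {Δ} (all A) (s≤s h) d with freshFor Γ (all A ∷ Δ)
  ... | c , f = ∀R c f (inStoup< n s (A [ cst c ]) (size-inst A (cst c) h) (invAll c d))

toLKF : ∀ {n Γ Δ} S → LKh n Γ (S ∷? Δ) → LKF Γ S Δ
toLKF nothing = unfocused _
toLKF (just B) = inStoup _ B

proposition2 : (Γ Δ' Δ : List Fm) (A : Maybe Fm) →
               LK Γ Δ' → Δ' ↭ (A ∷? Δ) → LKF Γ A Δ
proposition2 Γ Δ' Δ A d p = toLKF A (exchR p (proj₂ (fromLK d)))
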